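{- (DP semiring fusion.) Let $\mathbb{E}$ be an arbitrary type (of edge labels). Let $f$ be a function, written in a pure, lazy functional language (no side effects, no empty type), that is parametrically polymorphic in a type variable $\mathbb{S}$ with type $$f:\left(\mathbb{S}\times\mathbb{S}\to\mathbb{S}\right)\times\left(\mathbb{S}\times\mathbb{S}\to\mathbb{S}\right)\times\mathbb{S}\times\mathbb{S}\times\left(\mathbb{E}\to\mathbb{S}\right)\to\mathbb{S}.$$ For a semiring $\mathcal{S}=(\mathbb{S},\oplus,\otimes,i_{\oplus},i_{\otimes})$ and a map $w:\mathbb{E}\to\mathbb{S}$ write $f_{\mathcal{S},w}=f(\oplus,\otimes,i_{\oplus},i_{\otimes},w)$. Let $\mathcal{G}=(\{[\mathbb{E}]\},\cup,\circ,\emptyset,\{[\,]\})$ be the generator semiring and $w^{\prime}:\mathbb{E}\to\{[\mathbb{E}]\}$ be given by $w^{\prime}(e)=\{[e]\}$. Let $\mathcal{S}=(\mathbb{S},\oplus,\otimes,i_{\oplus},i_{\otimes})$ be an arbitrary semiring with a map $w:\mathbb{E}\to\mathbb{S}$. If there exists a semiring homomorphism $g_{\mathcal{S},w}:\{[\mathbb{E}]\}\to\mathbb{S}$ from $\mathcal{G}$ to $\mathcal{S}$, i.e. $g(x\cup y)=g(x)\oplus g(y)$, $g(x\circ y)=g(x)\otimes g(y)$, $g(\emptyset)=i_{\oplus}$, $g(\{[\,]\})=i_{\otimes}$ for all $x,y$, which additionally satisfies $g(\{[e]\})=w(e)$ for all $e\in\mathbb{E}$, then $$g_{\mathcal{S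},w}\left(f_{\mathcal{G},w^{\prime}}\right)=f_{\mathcal{S},w}.$$
   Context: A semiring $(\mathbb{S},\oplus,\otimes,i_{\oplus},i_{\otimes})$ consists of two binary operations with respective identities $i_{\oplus},i_{\otimes}$, where $\otimes$ left and right distributes over $\oplus$. $[\mathbb{E}]$ denotes the type of finite lists with elements in $\mathbb{E}$, and $\{[\mathbb{E}]\}$ the type of sets of such lists. In the generator semiring $\mathcal{G}$, $\cup$ is set union, and the cross-join $x\circ y$ of two sets of lists is the set of all concatenations $l\,l^{\prime}$ with $l\in x$, $l^{\prime}\in y$ (e.g. $\{[a,b],[c]\}\circ\{[d],[e]\}=\{[a,b,d],[a,b,e],[c,d],[c,e]\}$); its identities are the empty set $\emptyset$ and the set $\{[\,]\}$ containing only the empty list. -}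

module Defs where

open import Level using (Level; _⊔_; suc; Setω)
open import Data.List using (List; []; _∷_; _++_)
open import Data.Sum using (_⊎_)
open import Data.Product using (_×_; ∃₂)
open import Data.Empty.Polymorphic using (⊥)
open import Relation.Binary.PropositionalEquality using (_≡_)

-- The carrier {[E]} of the generator semiring: sets of lists over E,
-- represented as predicates on lists.
Gen : ∀ {e} → Set e → Set (suc e)
Gen {e} E = List E → Set e

module _ {e} {E : Set e} where

  _∪_ : Gen E → Gen E → Gen E
  (x ∪ y) l = x l ⊎ y l

  _⊙_ : Gen E → Gen E → Gen E
  (x ⊙ y) l = ∃₂ λ l₁ l₂ → x l₁ × y l₂ × l ≡ l₁ ++ l₂

  ∅ : Gen E
  ∅ _ = ⊥

  ε : Gen E
  ε l = l ≡ []

  w′ : E → Gen E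
  w′ a l = l ≡ a ∷ []

Poly : ∀ {e} → Set e → Setω
Poly E = ∀ {a} {S : Set a} → (S → S → S) → (S → S → S) → S → S → (E → S) → S

-- Parametric polymorphism (Reynolds' relational parametricity) of such f:
-- for every relation R between two instantiations, R-related arguments
-- give R-related results.
Parametric : ∀ {e} {E : Set e} → Poly E → Setω
Parametric {E = E} f =
  ∀ {a b r} {A : Set a} {B : Set b} (R : A → B → Set r)
    {p₁ q₁ : A → A → A} {p₂ q₂ : B → B → B} {z₁ o₁ : A} {z₂ o₂ : B}
    {w₁ : E → A} {w₂ : E → B} →
  (∀ {x₁ y₁ x₂ y₂} → R x₁ x₂ → R y₁ y₂ → R (p₁ x₁ y₁) (p₂ x₂ y₂)) →
  (∀ {x₁ y₁ x₂ y₂} → R x₁ x₂ → R y₁ y₂ → R (q₁ x₁ y₁) (q₂ x₂ y₂)) →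
  R z₁ z₂ → R o₁ o₂ → (∀ x → R (w₁ x) (w₂ x)) →
  R (f p₁ q₁ z₁ o₁ w₁) (f p₂ q₂ z₂ o₂ w₂)

{-# OPTIONS --safe #-}
module Submission where

open import Defs
open import Algebra.Bundles using (Semiring)
open import Algebra.Core using (Op₂)
open import Algebra.Definitions using (Congruent₂)
open import Relation.Binary.Bundles using (Setoid)
import Algebra.Morphism.Definitions as Morphism

-- The free theorem of f, taken at the graph relation  g x ≈ s  of g: the
-- relation is respected by the operations because g is a homomorphism and
-- the target operations are congruences.
module _ {e a c ℓ} {E : Set e} {A : Set a} (B : Setoid c ℓ) where
  open Setoid B using (Carrier; _≈_; trans)
  open Morphism A Carrier _≈_ using (Homomorphic₀; Homomorphic₂)

  parametric-fusion : (f : Poly E) → Parametric f →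
    {p₁ q₁ : Op₂ A} {z₁ o₁ : A} {w₁ : E → A}
    {p₂ q₂ : Op₂ Carrier} {z₂ o₂ : Carrier} {w₂ : E → Carrier} →
    Congruent₂ _≈_ p₂ → Congruent₂ _≈_ q₂ →
    (g : A → Carrier) → Homomorphic₂ g p₁ p₂ → Homomorphic₂ g q₁ q₂ →
    Homomorphic₀ g z₁ z₂ → Homomorphic₀ g o₁ o₂ → (∀ x → g (w₁ x) ≈ w₂ x) →
    g (f p₁ q₁ z₁ o₁ w₁) ≈ f p₂ q₂ z₂ o₂ w₂
  parametric-fusion f par p₂-cong q₂-cong g p-hom q-hom z-hom o-hom w-hom =
    par (λ x s → g x ≈ s)
      (λ {x₁} {y₁} gx≈s gy≈t → trans (p-hom x₁ y₁) (p₂-cong gx≈s gy≈t))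
      (λ {x₁} {y₁} gx≈s gy≈t → trans (q-hom x₁ y₁) (q₂-cong gx≈s gy≈t))
      z-hom o-hom w-hom

mainTheorem1 : ∀ {e c ℓ} {E : Set e} (f : Poly E) → Parametric f →
    (S : Semiring c ℓ) → (w : E → Semiring.Carrier S) →
    (g : Gen E → Semiring.Carrier S) →
    (∀ x y → Semiring._≈_ S (g (x ∪ y)) (Semiring._+_ S (g x) (g y))) →
    (∀ x y → Semiring._≈_ S (g (x ⊙ y)) (Semiring._*_ S (g x) (g y))) →
    Semiring._≈_ S (g ∅) (Semiring.0# S) →
    Semiring._≈_ S (g ε) (Semiring.1# S) →
    (∀ a → Semiring._≈_ S (g (w′ a)) (w a)) →
    Semiring._≈_ S (g (f _∪_ _⊙_ ∅ ε w′))
    (f (Semiring._+_ S) (Semiring._*_ S) (Semiring.0# S) (Semiring.1# S) w)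
mainTheorem1 f par S w g ∪-hom ⊙-hom ∅-hom ε-hom w′-hom =
  parametric-fusion setoid f par +-cong *-cong g ∪-hom ⊙-hom ∅-hom ε-hom w′-hom
  where open Semiring S using (setoid; +-cong; *-cong)
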